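{- Let $n>0$, let $k\in\{1,\dots,n\}$ and let $P$ be a Dyck path of semilength $k$. Then $P\leq (UD)^n$ in the Dyck pattern poset if and only if $\mathsf{asc}(P)\geq 2k-n$.
   Context: A Dyck path of semilength $k$ is a word over $\{U,D\}$ with $k$ letters $U$ and $k$ letters $D$ such that every prefix contains at least as many $U$'s as $D$'s. In the Dyck pattern poset, $P\leq Q$ means that $P$ is a subword of $Q$, i.e. $P$ can be obtained from $Q$ by deleting some letters (not necessarily consecutive). $(UD)^n$ denotes the word $UD$ repeated $n$ times. An ascent of a Dyck path is a maximal block of consecutive letters $U$; $\mathsf{asc}(P)$ is the number of ascents of $P$ (equivalently, its number of peaks, i.e. occurrences of $UD$ as consecutive letters). -}

module Defs where

open import Data.Nat using (ℕ; zero; suc; _+_; _≤_)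
open import Data.List using (List; []; _∷_; _++_; length; filter; replicate; concat)
open import Data.List.Relation.Binary.Sublist.Propositional using (_⊆_)
open import Relation.Binary.PropositionalEquality using (_≡_)

data Letter : Set where
  U D : Letter

Word : Set
Word = List Letter

#U : Word → ℕ
#U []       = 0
#U (U ∷ w)  = suc (#U w)
#U (D ∷ w)  = #U w

#D : Word → ℕ
#D []       = 0
#D (U ∷ w)  = #D w
#D (D ∷ w)  = suc (#D w)

PrefixOK : Word → Set
PrefixOK w = ∀ (p s : Word) → p ++ s ≡ w → #D p ≤ #U p

record IsDyck (k : ℕ) (w : Word) : Set where
  field
    numU     : #U w ≡ k
    numD     : #D w ≡ k
    prefixes : PrefixOK w

-- Dyck pattern order: P ≤ Q iff P is a (scattered) subword of Q
_≼_ : Word → Word → Set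
P ≼ Q = P ⊆ Q

UDpow : ℕ → Word
UDpow zero    = []
UDpow (suc n) = U ∷ D ∷ UDpow n

-- number of ascents = number of peaks = occurrences of consecutive UD
asc : Word → ℕ
asc []            = 0
asc (U ∷ D ∷ w)   = suc (asc (D ∷ w))
asc (_ ∷ w)       = asc w

-- Embed a word w greedily into U D U D …: a letter that differs from its
-- predecessor costs one letter of the alternating word, a repeated letter
-- costs two.  Hence the shortest prefix of (UD)^∞ containing w has length
-- 2|w| − 2 asc w − [w ends in U], and w ≤ (UD)^n iff |w| ≤ asc w + n.
-- For a Dyck path of semilength k only |P| = 2k is used.
module Submission where

open import Defs
open import Data.Nat using (ℕ; _≤_; _+_; _*_)
open import Function.Bundles using (_⇔_)

open import Data.Nat using (zero; suc; z≤n; s≤s; _≤?_)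
open import Data.Nat.Properties
  using (+-identityʳ; +-suc; *-suc; ≤-trans; ≤-refl; n≤1+n; m≤m+n;
         +-mono-≤; +-monoˡ-≤; +-cancelʳ-≤; *-monoʳ-≤; ≰⇒>; 1+n≰n; module ≤-Reasoning)
open import Data.Nat.Tactic.RingSolver using (solve-∀)
open import Data.List using ([]; _∷_; length)
open import Data.List.Relation.Binary.Sublist.Propositional {A = Letter}
  using (_⊆_; []; _∷ʳ_; _∷_; minimum)
open import Function.Bundles using (mk⇔)
open import Relation.Nullary using (yes; no; contradiction)
open import Relation.Binary.PropositionalEquality
  using (_≡_; refl; sym; cong; cong₂; subst; module ≡-Reasoning)

flip : Letter → Letter
flip U = D
flip D = U

alt : Letter → ℕ → Word
alt x zero    = []
alt x (suc m) = x ∷ alt (flip x) m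

UDpow≡alt : ∀ n → UDpow n ≡ alt U (2 * n)
UDpow≡alt zero    = refl
UDpow≡alt (suc n) = begin
  U ∷ D ∷ UDpow n   ≡⟨ cong (λ w → U ∷ D ∷ w) (UDpow≡alt n) ⟩
  alt U (2 + 2 * n) ≡⟨ cong (alt U) (*-suc 2 n) ⟨
  alt U (2 * suc n) ∎
  where open ≡-Reasoning

-- The least m with w ⊆ alt x m, attained by the greedy embedding.
altSpan : Letter → Word → ℕ
altSpan x []       = 0
altSpan U (U ∷ w)  = suc (altSpan D w)
altSpan U (D ∷ w)  = 2 + altSpan U w
altSpan D (D ∷ w)  = suc (altSpan U w)
altSpan D (U ∷ w)  = 2 + altSpan D w

altSpan≤1+altSpan-flip : ∀ x w → altSpan x w ≤ suc (altSpan (flip x) w)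
altSpan≤1+altSpan-flip x []      = z≤n
altSpan≤1+altSpan-flip U (U ∷ w) = s≤s (≤-trans (n≤1+n _) (n≤1+n _))
altSpan≤1+altSpan-flip U (D ∷ w) = ≤-refl
altSpan≤1+altSpan-flip D (D ∷ w) = s≤s (≤-trans (n≤1+n _) (n≤1+n _))
altSpan≤1+altSpan-flip D (U ∷ w) = ≤-refl

⊆alt⇒altSpan≤ : ∀ {x m w} → w ⊆ alt x m → altSpan x w ≤ m
⊆alt⇒altSpan≤ {m = zero}      []         = z≤n
⊆alt⇒altSpan≤ {x} {suc m} {w} (.x ∷ʳ p)  =
  ≤-trans (altSpan≤1+altSpan-flip x w) (s≤s (⊆alt⇒altSpan≤ p))
⊆alt⇒altSpan≤ {U} {suc m}     (refl ∷ p) = s≤s (⊆alt⇒altSpan≤ p)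
⊆alt⇒altSpan≤ {D} {suc m}     (refl ∷ p) = s≤s (⊆alt⇒altSpan≤ p)

altSpan≤⇒⊆alt : ∀ x w m → altSpan x w ≤ m → w ⊆ alt x m
altSpan≤⇒⊆alt x []      m             _               = minimum _
altSpan≤⇒⊆alt U (U ∷ w) (suc m)       (s≤s le)        = refl ∷ altSpan≤⇒⊆alt D w m le
altSpan≤⇒⊆alt U (D ∷ w) (suc (suc m)) (s≤s (s≤s le))  = U ∷ʳ (refl ∷ altSpan≤⇒⊆alt U w m le)
altSpan≤⇒⊆alt D (D ∷ w) (suc m)       (s≤s le)        = refl ∷ altSpan≤⇒⊆alt U w m le
altSpan≤⇒⊆alt D (U ∷ w) (suc (suc m)) (s≤s (s≤s le))  = D ∷ʳ (refl ∷ altSpan≤⇒⊆alt D w m le)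

endsInU : Word → ℕ
endsInU []          = 0
endsInU (_ ∷ y ∷ w) = endsInU (y ∷ w)
endsInU (U ∷ [])    = 1
endsInU (D ∷ [])    = 0

endsInU≤1 : ∀ w → endsInU w ≤ 1
endsInU≤1 []          = z≤n
endsInU≤1 (_ ∷ y ∷ w) = endsInU≤1 (y ∷ w)
endsInU≤1 (U ∷ [])    = ≤-refl
endsInU≤1 (D ∷ [])    = z≤n

endsInU-D∷ : ∀ w → endsInU (D ∷ w) ≡ endsInU w
endsInU-D∷ []      = refl
endsInU-D∷ (_ ∷ w) = refl

altSpan-U : ∀ w → altSpan U w + 2 * asc w + endsInU w ≡ 2 * length w
altSpan-U []          = refl
altSpan-U (U ∷ [])    = refl
altSpan-U (U ∷ U ∷ w) = begin
  2 + (altSpan U (U ∷ w) + 2 * asc (U ∷ w) + endsInU (U ∷ w)) ≡⟨ cong (2 +_) (altSpan-U (U ∷ w)) ⟩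
  2 + 2 * length (U ∷ w)                                      ≡⟨ *-suc 2 ((length (U ∷ w))) ⟨
  2 * length (U ∷ U ∷ w)                                      ∎
  where open ≡-Reasoning
altSpan-U (U ∷ D ∷ w) = begin
  2 + altSpan U w + 2 * suc (asc w) + endsInU (D ∷ w) ≡⟨ cong (2 + altSpan U w + 2 * suc (asc w) +_) (endsInU-D∷ w) ⟩
  2 + altSpan U w + 2 * suc (asc w) + endsInU w       ≡⟨ regroup (altSpan U w) (asc w) (endsInU w) ⟩
  4 + (altSpan U w + 2 * asc w + endsInU w)           ≡⟨ cong (4 +_) (altSpan-U w) ⟩
  4 + 2 * length w                                    ≡⟨ double (length w) ⟩
  2 * length (U ∷ D ∷ w)                              ∎
  where
  open ≡-Reasoning
  regroup : ∀ s a e → 2 + s + 2 * suc a + e ≡ 4 + (s + 2 * a + e)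
  regroup = solve-∀
  double : ∀ l → 4 + 2 * l ≡ 2 * (2 + l)
  double = solve-∀
altSpan-U (D ∷ w)     = begin
  2 + altSpan U w + 2 * asc w + endsInU (D ∷ w) ≡⟨ cong (2 + altSpan U w + 2 * asc w +_) (endsInU-D∷ w) ⟩
  2 + (altSpan U w + 2 * asc w + endsInU w)     ≡⟨ cong (2 +_) (altSpan-U w) ⟩
  2 + 2 * length w                              ≡⟨ *-suc 2 (length w) ⟨
  2 * length (D ∷ w)                            ∎
  where open ≡-Reasoning

2*m≤1+2*n⇒m≤n : ∀ {m n} → 2 * m ≤ suc (2 * n) → m ≤ n
2*m≤1+2*n⇒m≤n {m} {n} le with m ≤? n
... | yes m≤n = m≤n
... | no  m≰n = contradiction 2+2n≤1+2n 1+n≰n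
  where
  2+2n≤1+2n : 2 + 2 * n ≤ suc (2 * n)
  2+2n≤1+2n = subst (_≤ suc (2 * n)) (*-suc 2 n) (≤-trans (*-monoʳ-≤ 2 (≰⇒> m≰n)) le)

⊆UDpow⇔length≤asc+ : ∀ n w → w ⊆ UDpow n ⇔ length w ≤ asc w + n
⊆UDpow⇔length≤asc+ n w = mk⇔ to from
  where
  open ≤-Reasoning
  s = altSpan U w
  a = asc w
  e = endsInU w

  ⊆UDpow⇒altSpan≤ : w ⊆ UDpow n → s ≤ 2 * n
  ⊆UDpow⇒altSpan≤ w⊆ = ⊆alt⇒altSpan≤ (subst (w ⊆_) (UDpow≡alt n) w⊆)

  altSpan≤⇒⊆UDpow : s ≤ 2 * n → w ⊆ UDpow n
  altSpan≤⇒⊆UDpow le = subst (w ⊆_) (sym (UDpow≡alt n)) (altSpan≤⇒⊆alt U w (2 * n) le)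

  regroup : ∀ n a → 2 * n + 2 * a ≡ 2 * (a + n)
  regroup = solve-∀

  regroup+1 : ∀ n a → 2 * n + 2 * a + 1 ≡ suc (2 * (a + n))
  regroup+1 = solve-∀

  to : w ⊆ UDpow n → length w ≤ a + n
  to w⊆ = 2*m≤1+2*n⇒m≤n (begin
    2 * length w          ≡⟨ altSpan-U w ⟨
    s + 2 * a + e         ≤⟨ +-mono-≤ (+-monoˡ-≤ (2 * a) (⊆UDpow⇒altSpan≤ w⊆)) (endsInU≤1 w) ⟩
    2 * n + 2 * a + 1     ≡⟨ regroup+1 n a ⟩
    suc (2 * (a + n))     ∎)

  from : length w ≤ a + n → w ⊆ UDpow n
  from le = altSpan≤⇒⊆UDpow (+-cancelʳ-≤ (2 * a) s (2 * n) (begin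
    s + 2 * a             ≤⟨ m≤m+n (s + 2 * a) e ⟩
    s + 2 * a + e         ≡⟨ altSpan-U w ⟩
    2 * length w          ≤⟨ *-monoʳ-≤ 2 le ⟩
    2 * (a + n)           ≡⟨ regroup n a ⟨
    2 * n + 2 * a         ∎))

length≡#U+#D : ∀ w → length w ≡ #U w + #D w
length≡#U+#D []      = refl
length≡#U+#D (U ∷ w) = cong suc (length≡#U+#D w)
length≡#U+#D (D ∷ w) = begin
  suc (length w)    ≡⟨ cong suc (length≡#U+#D w) ⟩
  suc (#U w + #D w) ≡⟨ +-suc (#U w) (#D w) ⟨
  #U w + suc (#D w) ∎
  where open ≡-Reasoning

length-Dyck : ∀ {k P} → IsDyck k P → length P ≡ 2 * k
length-Dyck {k} {P} dyck = begin
  length P      ≡⟨ length≡#U+#D P ⟩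
  #U P + #D P   ≡⟨ cong₂ _+_ (IsDyck.numU dyck) (IsDyck.numD dyck) ⟩
  k + k         ≡⟨ cong (k +_) (+-identityʳ k) ⟨
  2 * k         ∎
  where open ≡-Reasoning

mainTheorem1 : (n k : ℕ) → 1 ≤ k → k ≤ n → (P : Word) → IsDyck k P →
    (P ≼ UDpow n) ⇔ (2 * k ≤ asc P + n)
mainTheorem1 n k _ _ P dyck =
  subst (λ l → P ≼ UDpow n ⇔ l ≤ asc P + n) (length-Dyck dyck) (⊆UDpow⇔length≤asc+ n P)
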